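{- Let $n,r$ be positive integers and let $M(n,r)$ be the maximum of $\mathcal{R}(\mathcal{F})=\Delta(\mathcal{F})/\delta(\mathcal{F})$ over all maximal intersecting families $\mathcal{F}\subseteq\binom{[n]}{r}$ with $\bigcup\mathcal{F}=[n]$. (i) For any values of $n$ and $r$, $M(n,r)\le n+r^r$. In particular, if $r=r(n)<\frac{\log n}{\log\log n}$, then $M(n,r)\le(1+o(1))n$ as $n\to\infty$. (ii) If $2r+2<n$, then \[ M(n,r)\ge n-2r+3-\frac{n-2r+2}{\binom{2r-3}{r-2}}. \] In particular, if $r=r(n)$ satisfies $r=\omega(1)$ and $r<\frac{\log n}{\log\log n}$, then $M(n,r)\sim n$ as $n\to\infty$.
   Context: $[n]=\{1,\dots,n\}$ and $\binom{[n]}{r}$ is the set of $r$-element subsets of $[n]$. A family $\mathcal{F}$ of sets is intersecting if $F_1\cap F_2\neq\emptyset$ for all $F_1,F_2\in\mathcal{F}$. An intersecting family $\mathcal{F}\subseteq\binom{[n]}{r}$ is maximal if for every $G\in\binom{[n]}{r}\setminus\mathcal{F}$ there is $F\in\mathcal{F}$ with $F\cap G=\emptyset$. The degree of $x\in[n]$ in $\mathcal{F}$ is the number of sets of $\mathcal{F}$ containing $x$; $\Delta(\mathcal{F})$ and $\delta(\mathcal{F})$ denote the maximum and minimum degree over $x\in[n]$ (the condition $\bigcup\mathcal{F}=[n]$ ensures $\delta(\mathcal{F})>0$). Asymptotic notation refers to $n\to\infty$ with $r=r(n)$. -}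

module Defs where

open import Data.Nat using (ℕ; zero; suc; _⊔_; _⊓_)
open import Data.Fin using (Fin)
open import Data.Fin.Subset using (Subset; _∈_; _∩_; ∣_∣; Nonempty; Empty)
open import Data.Fin.Subset.Properties using (_∈?_)
open import Data.List using (List; length; filter; foldr; allFin)
open import Data.List.Relation.Unary.All using (All)
open import Data.List.Relation.Unary.Unique.Propositional using (Unique)
open import Data.List.Membership.Propositional renaming (_∈_ to _∈ᴸ_)
open import Data.Product using (Σ; _×_; ∃)
open import Relation.Binary.PropositionalEquality using (_≡_)
open import Relation.Nullary using (¬_)

-- A family of subsets of [n] = Fin n, given as a duplicate-free list.
Family : ℕ → Set
Family n = List (Subset n)

Uniform : ∀ {n} → ℕ → Family n → Set
Uniform r 𝓕 = All (λ A → ∣ A ∣ ≡ r) 𝓕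

Intersecting : ∀ {n} → Family n → Set
Intersecting 𝓕 = ∀ {A B} → A ∈ᴸ 𝓕 → B ∈ᴸ 𝓕 → Nonempty (A ∩ B)

Maximal : ∀ {n} → ℕ → Family n → Set
Maximal {n} r 𝓕 = ∀ (G : Subset n) → ∣ G ∣ ≡ r → ¬ (G ∈ᴸ 𝓕) →
  Σ (Subset n) λ A → A ∈ᴸ 𝓕 × Empty (A ∩ G)

Covers : ∀ {n} → Family n → Set
Covers {n} 𝓕 = ∀ (x : Fin n) → Σ (Subset n) λ A → A ∈ᴸ 𝓕 × x ∈ A

Admissible : (n r : ℕ) → Family n → Set
Admissible n r 𝓕 =
  Unique 𝓕 × Uniform r 𝓕 × Intersecting 𝓕 × Maximal r 𝓕 × Covers 𝓕

degree : ∀ {n} → Family n → Fin n → ℕ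
degree 𝓕 x = length (filter (x ∈?_) 𝓕)

maxDeg : ∀ {n} → Family n → ℕ
maxDeg {n} 𝓕 = foldr (λ x m → degree 𝓕 x ⊔ m) 0 (allFin n)

-- δ(𝓕): minimum degree (n = 0 never occurs in the theorem)
minDeg : ∀ {n} → Family n → ℕ
minDeg {zero} 𝓕 = 0
minDeg {suc n} 𝓕 = foldr (λ x m → degree 𝓕 x ⊓ m) (degree 𝓕 Fin.zero) (allFin (suc n))

{-# OPTIONS --safe #-}

-- (i) Let x have minimum degree δ. Call A ∈ 𝓕 shiftable if A − a + x ∈ 𝓕 for some a ∈ A;
-- every set through x is (take a = x), and A is recovered from (A − a + x, a), so at most
-- nδ sets are shiftable. A non-shiftable A avoids x, so for S ⊊ A and a ∈ A ∖ S the r-set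
-- A − a + x lies outside 𝓕, and maximality gives a member B of 𝓕 missing it, hence missing S;
-- every member through S then contains S plus a point of B. Branching r times over such
-- B bounds the non-shiftable sets by r^r, so Δ ≤ |𝓕| ≤ nδ + r^r ≤ (n + r^r)δ.
--
-- (ii) On [n] = Z ∪ {y} ∪ W with |Z| = 2r − 3 and |W| = k = n − 2r + 2 there is a maximal
-- intersecting family in which y has degree at least C + k(C − 1) while every w ∈ W has
-- degree at most C = C(2r − 3, r − 2); hence Δ/δ ≥ k + 1 − k/C.

module Submission where

open import Defs
open import Data.Nat
  using (ℕ; zero; suc; pred; NonZero; >-nonZero; _+_; _*_; _∸_; _^_; _≤_; _<_; z≤n; s≤s; _⊔_; _⊓_)
open import Data.Nat.Properties
open import Data.Nat.Combinatorics using (_C_; nCk+nC[k+1]≡[n+1]C[k+1]; nCk≡nC[n∸k])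
open import Data.Bool using (_∧_) renaming (_≟_ to _≟ᵇ_)
open import Data.Fin using (Fin; zero; suc; _↑ˡ_; _↑ʳ_; splitAt) renaming (_≟_ to _≟ᶠ_)
open import Data.Fin.Properties using (¬∀⟶∃¬; any?; splitAt⁻¹-↑ˡ; splitAt⁻¹-↑ʳ)
open import Data.Bool.Properties using (¬-not)
open import Data.Fin.Subset
  using (Subset; Side; ⊥; ⊤; inside; outside; _∈_; _∉_; _⊆_; _∩_; ∁; ∣_∣; ⁅_⁆; Nonempty; Empty)
open import Data.Fin.Subset.Properties
  using (_∈?_; _⊆?_; nonempty?; ⊆-antisym; ⊆-reflexive; s⊆s; ⊥⊆; drop-there; ∉⊥; ∩-comm;
         x∈⁅x⁆; x∈⁅y⁆⇒x≡y; x∈p∩q⁺; x∈p∩q⁻; x∉p⇒x∈∁p; x∈∁p⇒x∉p; ∁p⊆∁q⇒p⊇q;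
         ∣⊤∣≡n; ∣⊥∣≡0; ∣⁅x⁆∣≡1; ∣p∣≤n; ∣∁p∣≡n∸∣p∣; p⊆q⇒∣p∣≤∣q∣; p⊂q⇒∣p∣<∣q∣)
open import Data.Vec using ([]; _∷_; _[_]≔_; lookup; here; there) renaming (_++_ to _++ᵛ_; splitAt to splitAtᵛ)
open import Data.Vec.Properties
  using (≡-dec; ∷-injective; ∷-injectiveʳ; ++-injective; zipWith-++; lookup-++ˡ; lookup-++ʳ;
         []≔-idempotent; []≔-commutes; []≔-updates; []≔-minimal; []≔-lookup; lookup∘update′;
         []=⇒lookup; lookup⇒[]=)
open import Data.List
  using (List; []; _∷_; _++_; [_]; length; map; concatMap; cartesianProductWith; filter; foldr; allFin)
open import Data.List.Properties using (length-++; length-map; length-tabulate; length-filter; filter-all; filter-some)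
open import Data.List.Relation.Unary.Unique.Propositional.Properties using (filter⁺; ++⁺)
import Data.List.Relation.Unary.Unique.Propositional.Properties as Unique
open import Data.List.Relation.Unary.All as All using (All; [])
import Data.List.Relation.Unary.All.Properties as All
import Data.List.Relation.Unary.Any
open Data.List.Relation.Unary.Any using (here; there)
open import Data.List.Relation.Unary.AllPairs using ([]; _∷_)
open import Data.List.Relation.Unary.Unique.Propositional using (Unique)
open import Data.List.Membership.Propositional using () renaming (_∈_ to _∈ᴸ_)
open import Data.List.Membership.Propositional.Properties
  using (∈-∃++; ∈-++⁻; ∈-++⁺ˡ; ∈-++⁺ʳ; ∈-map⁺; ∈-map⁻; ∈-concat⁺′; ∈-filter⁺; ∈-filter⁻; ∈-allFin;
         ∈-cartesianProductWith⁺; ∈-cartesianProductWith⁻)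
open import Data.List.Relation.Binary.Subset.Propositional using () renaming (_⊆_ to _⊆ᴸ_)
open import Data.Product using (Σ; _×_; _,_; proj₁; proj₂; ∃)
open import Data.Nat.Solver using (module +-*-Solver)
open +-*-Solver using (solve; _:+_; _:*_; _:=_; con)
open import Data.Sum using (_⊎_; inj₁; inj₂)
open import Relation.Nullary using (¬_; yes; no; ¬?; _→-dec_; _×-dec_; contradiction)
open import Relation.Unary using (Pred; Decidable)
open import Relation.Binary.PropositionalEquality hiding ([_])
open import Relation.Binary.Definitions using (DecidableEquality; tri<; tri≈; tri>)
open import Function using (_∘_)

private variable
  n : ℕ

module _ {a} {A : Set a} where

  Unique⇒length≤ : ∀ {xs ys : List A} → Unique xs → xs ⊆ᴸ ys → length xs ≤ length ys
  Unique⇒length≤ {[]} _ _ = z≤n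
  Unique⇒length≤ {x ∷ xs} (x∉xs ∷ u) xs⊆ys with ys₁ , ys₂ , refl ← ∈-∃++ (xs⊆ys (here refl)) = begin
    suc (length xs)                 ≤⟨ s≤s (Unique⇒length≤ u xs⊆ys₁ys₂) ⟩
    suc (length (ys₁ ++ ys₂))       ≡⟨ cong suc (length-++ ys₁) ⟩
    suc (length ys₁ + length ys₂)   ≡⟨ +-suc (length ys₁) (length ys₂) ⟨
    length ys₁ + length (x ∷ ys₂)   ≡⟨ length-++ ys₁ ⟨
    length (ys₁ ++ x ∷ ys₂)         ∎
    where
    open ≤-Reasoning
    xs⊆ys₁ys₂ : xs ⊆ᴸ ys₁ ++ ys₂
    xs⊆ys₁ys₂ {z} z∈xs with ∈-++⁻ ys₁ (xs⊆ys (there z∈xs))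
    ... | inj₁ z∈ys₁         = ∈-++⁺ˡ z∈ys₁
    ... | inj₂ (here refl)   = contradiction refl (All.lookup x∉xs z∈xs)
    ... | inj₂ (there z∈ys₂) = ∈-++⁺ʳ ys₁ z∈ys₂

  length-concatMap≤ : ∀ {b} {B : Set b} (f : B → List A) {c} (xs : List B) →
    (∀ {x} → x ∈ᴸ xs → length (f x) ≤ c) → length (concatMap f xs) ≤ length xs * c
  length-concatMap≤ f []       _ = z≤n
  length-concatMap≤ f (x ∷ xs) h = begin
    length (f x ++ concatMap f xs)          ≡⟨ length-++ (f x) ⟩
    length (f x) + length (concatMap f xs)  ≤⟨ +-mono-≤ (h (here refl)) (length-concatMap≤ f xs (h ∘ there)) ⟩
    _ + length xs * _                       ∎
    where open ≤-Reasoning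

  length-filter+filter-∁ : ∀ {p} {P : Pred A p} (P? : Decidable P) xs →
    length (filter P? xs) + length (filter (¬? ∘ P?) xs) ≡ length xs
  length-filter+filter-∁ P? [] = refl
  length-filter+filter-∁ P? (x ∷ xs) with P? x
  ... | yes _ = cong suc (length-filter+filter-∁ P? xs)
  ... | no  _ = trans (+-suc _ _) (cong suc (length-filter+filter-∁ P? xs))

  length≤-from-elements : ∀ {c} (xs : List A) → (∀ {x} → x ∈ᴸ xs → length xs ≤ c) → length xs ≤ c
  length≤-from-elements []      _ = z≤n
  length≤-from-elements (x ∷ xs) h = h (here refl)

  Unique-++ : ∀ {p} {P : Pred A p} {xs ys : List A} →
    Unique xs → Unique ys → All P xs → All (¬_ ∘ P) ys → Unique (xs ++ ys)
  Unique-++ xs! ys! Pxs ¬Pys = ++⁺ xs! ys! λ (z∈xs , z∈ys) → All.lookup ¬Pys z∈ys (All.lookup Pxs z∈xs)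

  length-filter-≢ : (_≟_ : DecidableEquality A) {x : A} {xs : List A} → Unique xs → x ∈ᴸ xs →
    suc (length (filter (λ y → ¬? (y ≟ x)) xs)) ≡ length xs
  length-filter-≢ _≟_ {x} {_ ∷ xs} (x∉xs ∷ _) (here refl) with x ≟ x
  ... | yes _   = cong (suc ∘ length) (filter-all (λ y → ¬? (y ≟ x)) (All.map ≢-sym x∉xs))
  ... | no  x≢x = contradiction refl x≢x
  length-filter-≢ _≟_ {x} {y ∷ xs} (y∉xs ∷ xs!) (there x∈xs) with y ≟ x
  ... | yes refl = contradiction refl (All.lookup y∉xs x∈xs)
  ... | no  _    = cong suc (length-filter-≢ _≟_ xs! x∈xs)

  length-cartesianProductWith : ∀ {b c} {B : Set b} {C : Set c} (f : B → C → A) xs ys →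
    length (cartesianProductWith f xs ys) ≡ length xs * length ys
  length-cartesianProductWith f []       ys = refl
  length-cartesianProductWith f (x ∷ xs) ys = begin
    length (map (f x) ys ++ cartesianProductWith f xs ys)       ≡⟨ length-++ (map (f x) ys) ⟩
    length (map (f x) ys) + length (cartesianProductWith f xs ys) ≡⟨ cong₂ _+_ (length-map (f x) ys) (length-cartesianProductWith f xs ys) ⟩
    length ys + length xs * length ys                          ∎
    where open ≡-Reasoning

m+n≡o∧o≤m⇒m≡o∧n≡0 : ∀ m {n o} → m + n ≡ o → o ≤ m → m ≡ o × n ≡ 0
m+n≡o∧o≤m⇒m≡o∧n≡0 m {n} refl m+n≤m = trans (sym (+-identityʳ m)) (cong (m +_) (sym n≡0)) , n≡0
  where
  n≡0 : n ≡ 0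
  n≡0 = n≤0⇒n≡0 (+-cancelˡ-≤ m n 0 (subst (m + n ≤_) (sym (+-identityʳ m)) m+n≤m))

m≡o∧m+n≡1+o⇒n≡1 : ∀ {m n o} → m ≡ o → m + n ≡ suc o → n ≡ 1
m≡o∧m+n≡1+o⇒n≡1 {o = o} refl m+n≡1+o = +-cancelˡ-≡ o _ 1 (trans m+n≡1+o (sym (+-comm o 1)))

a*c≤d+b∧e≤c⇒a*c*e≤d*c+b*e : ∀ {a b c d e} → a * c ≤ d + b → e ≤ c → a * c * e ≤ d * c + b * e
a*c≤d+b∧e≤c⇒a*c*e≤d*c+b*e {a} {b} {c} {d} {e} a*c≤d+b e≤c = begin
  a * c * e       ≤⟨ *-monoˡ-≤ e a*c≤d+b ⟩
  (d + b) * e     ≡⟨ *-distribʳ-+ e d b ⟩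
  d * e + b * e   ≤⟨ +-monoˡ-≤ (b * e) (*-monoʳ-≤ d e≤c) ⟩
  d * c + b * e   ∎
  where open ≤-Reasoning

-- Subsets of Fin n

lookup≡outside : {p : Subset n} {x : Fin n} → x ∉ p → lookup p x ≡ outside
lookup≡outside x∉p = ¬-not (x∉p ∘ lookup⇒[]= _ _)

p[x]≔inside≡p : (p : Subset n) {x : Fin n} → x ∈ p → p [ x ]≔ inside ≡ p
p[x]≔inside≡p p {x} x∈p = trans (cong (p [ x ]≔_) (sym ([]=⇒lookup x∈p))) ([]≔-lookup p x)

p[x]≔outside≡p : (p : Subset n) {x : Fin n} → x ∉ p → p [ x ]≔ outside ≡ p
p[x]≔outside≡p p {x} x∉p = trans (cong (p [ x ]≔_) (sym (lookup≡outside x∉p))) ([]≔-lookup p x)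

∈-[]≔⁻ : (p : Subset n) {x y : Fin n} {b : Side} → y ≢ x → y ∈ p [ x ]≔ b → y ∈ p
∈-[]≔⁻ p {b = b} y≢x y∈ = lookup⇒[]= _ p (trans (sym (lookup∘update′ y≢x p b)) ([]=⇒lookup y∈))

⊆-[]≔inside : (p : Subset n) (x : Fin n) → p ⊆ p [ x ]≔ inside
⊆-[]≔inside p x {y} y∈p with y ≟ᶠ x
... | yes refl = []≔-updates p x
... | no  y≢x  = []≔-minimal p y x y≢x y∈p

∣p[x]≔inside∣≡suc∣p∣ : (p : Subset n) {x : Fin n} → x ∉ p → ∣ p [ x ]≔ inside ∣ ≡ suc ∣ p ∣
∣p[x]≔inside∣≡suc∣p∣ (inside  ∷ p) {zero}  x∉p = contradiction here x∉p
∣p[x]≔inside∣≡suc∣p∣ (outside ∷ p) {zero}  x∉p = refl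
∣p[x]≔inside∣≡suc∣p∣ (inside  ∷ p) {suc x} x∉p = cong suc (∣p[x]≔inside∣≡suc∣p∣ p (x∉p ∘ there))
∣p[x]≔inside∣≡suc∣p∣ (outside ∷ p) {suc x} x∉p = ∣p[x]≔inside∣≡suc∣p∣ p (x∉p ∘ there)

suc∣p[x]≔outside∣≡∣p∣ : (p : Subset n) {x : Fin n} → x ∈ p → suc ∣ p [ x ]≔ outside ∣ ≡ ∣ p ∣
suc∣p[x]≔outside∣≡∣p∣ (inside  ∷ p) here        = refl
suc∣p[x]≔outside∣≡∣p∣ (inside  ∷ p) (there x∈p) = cong suc (suc∣p[x]≔outside∣≡∣p∣ p x∈p)
suc∣p[x]≔outside∣≡∣p∣ (outside ∷ p) (there x∈p) = suc∣p[x]≔outside∣≡∣p∣ p x∈p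

∣q∣<∣p∣⇒∃p∖q : {p q : Subset n} → ∣ q ∣ < ∣ p ∣ → ∃ λ x → x ∈ p × x ∉ q
∣q∣<∣p∣⇒∃p∖q {n} {p} {q} ∣q∣<∣p∣
  with x , x∈p⇏x∈q ← ¬∀⟶∃¬ n (λ x → x ∈ p → x ∈ q) (λ x → x ∈? p →-dec x ∈? q)
                         (λ p⊆q → <⇒≱ ∣q∣<∣p∣ (p⊆q⇒∣p∣≤∣q∣ (p⊆q _)))
  with x ∈? p
... | yes x∈p = x , x∈p , λ x∈q → x∈p⇏x∈q (λ _ → x∈q)
... | no  x∉p = contradiction (λ x∈p → contradiction x∈p x∉p) x∈p⇏x∈q

⊆∧∣∣≤⇒≡ : {p q : Subset n} → p ⊆ q → ∣ q ∣ ≤ ∣ p ∣ → q ≡ p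
⊆∧∣∣≤⇒≡ {p = p} {q} p⊆q ∣q∣≤∣p∣ = ⊆-antisym q⊆p p⊆q
  where
  q⊆p : q ⊆ p
  q⊆p {x} x∈q with x ∈? p
  ... | yes x∈p = x∈p
  ... | no  x∉p = contradiction ∣q∣≤∣p∣ (<⇒≱ (p⊂q⇒∣p∣<∣q∣ (p⊆q , x , x∈q , x∉p)))

∣p∣≡0⇒p≡⊥ : (p : Subset n) → ∣ p ∣ ≡ 0 → p ≡ ⊥
∣p∣≡0⇒p≡⊥ []            _  = refl
∣p∣≡0⇒p≡⊥ (inside  ∷ p) ()
∣p∣≡0⇒p≡⊥ (outside ∷ p) eq = cong (outside ∷_) (∣p∣≡0⇒p≡⊥ p eq)

∣p∣≡1⇒p≡⁅x⁆ : (p : Subset n) → ∣ p ∣ ≡ 1 → ∃ λ x → p ≡ ⁅ x ⁆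
∣p∣≡1⇒p≡⁅x⁆ (inside  ∷ p) eq = zero , cong (inside ∷_) (∣p∣≡0⇒p≡⊥ p (suc-injective eq))
∣p∣≡1⇒p≡⁅x⁆ (outside ∷ p) eq = let x , p≡⁅x⁆ = ∣p∣≡1⇒p≡⁅x⁆ p eq in suc x , cong (outside ∷_) p≡⁅x⁆

⁅⁆-injective : {x y : Fin n} → ⁅ x ⁆ ≡ ⁅ y ⁆ → x ≡ y
⁅⁆-injective {x = x} {y} eq = x∈⁅y⁆⇒x≡y y (subst (x ∈_) eq (x∈⁅x⁆ x))

∁-injective : {p q : Subset n} → ∁ p ≡ ∁ q → p ≡ q
∁-injective eq = ⊆-antisym (∁p⊆∁q⇒p⊇q (⊆-reflexive (sym eq))) (∁p⊆∁q⇒p⊇q (⊆-reflexive eq))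

Empty-∩⇒⊆∁ : {p q : Subset n} → Empty (p ∩ q) → p ⊆ ∁ q
Empty-∩⇒⊆∁ p∩q≡∅ {x} x∈p = x∉p⇒x∈∁p λ x∈q → p∩q≡∅ (x , x∈p∩q⁺ (x∈p , x∈q))

Nonempty-∩-comm : {p q : Subset n} → Nonempty (p ∩ q) → Nonempty (q ∩ p)
Nonempty-∩-comm {p = p} {q} (x , x∈p∩q) = x , subst (x ∈_) (∩-comm p q) x∈p∩q

⊆∁⇒Empty-∩ : {p q : Subset n} → p ⊆ ∁ q → Empty (p ∩ q)
⊆∁⇒Empty-∩ {p = p} {q} p⊆∁q (x , x∈p∩q) with x∈p , x∈q ← x∈p∩q⁻ p q x∈p∩q = x∈∁p⇒x∉p (p⊆∁q x∈p) x∈q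

Empty-∩-∁ : (p : Subset n) → Empty (p ∩ ∁ p)
Empty-∩-∁ p (x , x∈p∩∁p) with x∈p , x∈∁p ← x∈p∩q⁻ p (∁ p) x∈p∩∁p = x∈∁p⇒x∉p x∈∁p x∈p

Empty-⊥∩ : (p : Subset n) → Empty (⊥ ∩ p)
Empty-⊥∩ p (x , x∈⊥∩p) = ∉⊥ (proj₁ (x∈p∩q⁻ ⊥ p x∈⊥∩p))

Empty-⁅⁆∩⁅⁆ : {x y : Fin n} → x ≢ y → Empty (⁅ x ⁆ ∩ ⁅ y ⁆)
Empty-⁅⁆∩⁅⁆ {x = x} {y} x≢y (z , z∈) with z∈⁅x⁆ , z∈⁅y⁆ ← x∈p∩q⁻ ⁅ x ⁆ ⁅ y ⁆ z∈ =
  x≢y (trans (sym (x∈⁅y⁆⇒x≡y x z∈⁅x⁆)) (x∈⁅y⁆⇒x≡y y z∈⁅y⁆))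

Nonempty-∩ : (p q : Subset n) → n < ∣ p ∣ + ∣ q ∣ → Nonempty (p ∩ q)
Nonempty-∩ {n} p q n<∣p∣+∣q∣ with nonempty? (p ∩ q)
... | yes p∩q≢∅ = p∩q≢∅
... | no  p∩q≡∅ = contradiction n<∣p∣+∣q∣ (≤⇒≯ (begin
  ∣ p ∣ + ∣ q ∣        ≤⟨ +-monoˡ-≤ ∣ q ∣ (p⊆q⇒∣p∣≤∣q∣ (Empty-∩⇒⊆∁ p∩q≡∅)) ⟩
  ∣ ∁ q ∣ + ∣ q ∣      ≡⟨ cong (_+ ∣ q ∣) (∣∁p∣≡n∸∣p∣ q) ⟩
  n ∸ ∣ q ∣ + ∣ q ∣    ≡⟨ m∸n+n≡m (∣p∣≤n q) ⟩
  n                    ∎))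
  where open ≤-Reasoning

⊆-of-size : (p : Subset n) {t : ℕ} → t ≤ ∣ p ∣ → ∃ λ q → q ⊆ p × ∣ q ∣ ≡ t
⊆-of-size {n} p {zero} _ = ⊥ , ⊥⊆ , ∣⊥∣≡0 n
⊆-of-size (inside  ∷ p) {suc t} (s≤s t≤∣p∣) =
  let q , q⊆p , ∣q∣≡t = ⊆-of-size p t≤∣p∣ in inside ∷ q , s⊆s q⊆p , cong suc ∣q∣≡t
⊆-of-size (outside ∷ p) {suc t} t<∣p∣ =
  let q , q⊆p , ∣q∣≡t = ⊆-of-size p t<∣p∣ in outside ∷ q , s⊆s q⊆p , ∣q∣≡t

⊆∁-of-size : (p : Subset n) {a : ℕ} → ∣ p ∣ + a ≤ n → ∃ λ q → q ⊆ ∁ p × ∣ q ∣ ≡ a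
⊆∁-of-size {n} p {a} ∣p∣+a≤n =
  ⊆-of-size (∁ p) (subst (a ≤_) (sym (∣∁p∣≡n∸∣p∣ p)) (m+n≤o⇒m≤o∸n a (subst (_≤ n) (+-comm ∣ p ∣ a) ∣p∣+a≤n)))

elements : Subset n → List (Fin n)
elements []            = []
elements (inside  ∷ p) = zero ∷ map suc (elements p)
elements (outside ∷ p) = map suc (elements p)

length-elements : (p : Subset n) → length (elements p) ≡ ∣ p ∣
length-elements []            = refl
length-elements (inside  ∷ p) = cong suc (trans (length-map suc (elements p)) (length-elements p))
length-elements (outside ∷ p) = trans (length-map suc (elements p)) (length-elements p)

∈-elements⁺ : (p : Subset n) {x : Fin n} → x ∈ p → x ∈ᴸ elements p
∈-elements⁺ (inside  ∷ p) here        = here refl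
∈-elements⁺ (inside  ∷ p) (there x∈p) = there (∈-map⁺ suc (∈-elements⁺ p x∈p))
∈-elements⁺ (outside ∷ p) (there x∈p) = ∈-map⁺ suc (∈-elements⁺ p x∈p)

∈-elements⁻ : (p : Subset n) {x : Fin n} → x ∈ᴸ elements p → x ∈ p
∈-elements⁻ (inside  ∷ p) (here refl) = here
∈-elements⁻ (inside  ∷ p) (there x∈) with _ , y∈ , refl ← ∈-map⁻ suc x∈ = there (∈-elements⁻ p y∈)
∈-elements⁻ (outside ∷ p) x∈ with _ , y∈ , refl ← ∈-map⁻ suc x∈ = there (∈-elements⁻ p y∈)

choose : (n t : ℕ) → List (Subset n)
choose n       zero    = [ ⊥ ]
choose zero    (suc t) = []
choose (suc n) (suc t) = map (inside ∷_) (choose n t) ++ map (outside ∷_) (choose n (suc t))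

∈-choose⁻ : ∀ n t {p : Subset n} → p ∈ᴸ choose n t → ∣ p ∣ ≡ t
∈-choose⁻ n zero (here refl) = ∣⊥∣≡0 n
∈-choose⁻ (suc n) (suc t) p∈ with ∈-++⁻ (map (inside ∷_) (choose n t)) p∈
... | inj₁ p∈₁ with _ , q∈ , refl ← ∈-map⁻ (inside ∷_) p∈₁ = cong suc (∈-choose⁻ n t q∈)
... | inj₂ p∈₂ with _ , q∈ , refl ← ∈-map⁻ (outside ∷_) p∈₂ = ∈-choose⁻ n (suc t) q∈

∈-choose⁺ : ∀ {n t} (p : Subset n) → ∣ p ∣ ≡ t → p ∈ᴸ choose n t
∈-choose⁺ {t = zero} p ∣p∣≡0 = here (∣p∣≡0⇒p≡⊥ p ∣p∣≡0)
∈-choose⁺ {t = suc t} (inside ∷ p) ∣p∣≡1+t =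
  ∈-++⁺ˡ (∈-map⁺ (inside ∷_) (∈-choose⁺ p (suc-injective ∣p∣≡1+t)))
∈-choose⁺ {suc n} {suc t} (outside ∷ p) ∣p∣≡1+t =
  ∈-++⁺ʳ (map (inside ∷_) (choose n t)) (∈-map⁺ (outside ∷_) (∈-choose⁺ p ∣p∣≡1+t))

length-choose : ∀ n t → length (choose n t) ≡ n C t
length-choose n       zero    = refl
length-choose zero    (suc t) = refl
length-choose (suc n) (suc t) = begin
  length (map (inside ∷_) (choose n t) ++ map (outside ∷_) (choose n (suc t)))
    ≡⟨ length-++ (map (inside ∷_) (choose n t)) ⟩
  length (map (inside ∷_) (choose n t)) + length (map (outside ∷_) (choose n (suc t)))
    ≡⟨ cong₂ _+_ (length-map (inside ∷_) (choose n t)) (length-map (outside ∷_) (choose n (suc t))) ⟩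
  length (choose n t) + length (choose n (suc t))
    ≡⟨ cong₂ _+_ (length-choose n t) (length-choose n (suc t)) ⟩
  n C t + n C suc t
    ≡⟨ nCk+nC[k+1]≡[n+1]C[k+1] n t ⟩
  suc n C suc t ∎
  where open ≡-Reasoning

choose-unique : ∀ n t → Unique (choose n t)
choose-unique n       zero    = [] ∷ []
choose-unique zero    (suc t) = []
choose-unique (suc n) (suc t) =
  Unique-++ {P = zero ∈_} (Unique.map⁺ ∷-injectiveʳ (choose-unique n t)) (Unique.map⁺ ∷-injectiveʳ (choose-unique n (suc t)))
            (All.map⁺ (All.tabulate λ _ → here)) (All.map⁺ (All.tabulate λ _ ()))

∣++ᵛ∣ : ∀ {m} (p : Subset m) (q : Subset n) → ∣ p ++ᵛ q ∣ ≡ ∣ p ∣ + ∣ q ∣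
∣++ᵛ∣ []            q = refl
∣++ᵛ∣ (inside  ∷ p) q = cong suc (∣++ᵛ∣ p q)
∣++ᵛ∣ (outside ∷ p) q = ∣++ᵛ∣ p q

module _ {m n : ℕ} where

  ∈-++ᵛ⁺ˡ : {p : Subset m} {q : Subset n} {x : Fin m} → x ∈ p → x ↑ˡ n ∈ p ++ᵛ q
  ∈-++ᵛ⁺ˡ {p = p} {q} {x} x∈p = lookup⇒[]= _ (p ++ᵛ q) (trans (lookup-++ˡ p q x) ([]=⇒lookup x∈p))

  ∈-++ᵛ⁺ʳ : (p : Subset m) {q : Subset n} {x : Fin n} → x ∈ q → m ↑ʳ x ∈ p ++ᵛ q
  ∈-++ᵛ⁺ʳ p {q} {x} x∈q = lookup⇒[]= _ (p ++ᵛ q) (trans (lookup-++ʳ p q x) ([]=⇒lookup x∈q))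

  ∈-++ᵛ⁻ʳ : (p : Subset m) {q : Subset n} {x : Fin n} → m ↑ʳ x ∈ p ++ᵛ q → x ∈ q
  ∈-++ᵛ⁻ʳ p {q} {x} x∈ = lookup⇒[]= x q (trans (sym (lookup-++ʳ p q x)) ([]=⇒lookup x∈))

Nonempty-++ᵛ⁻ : ∀ {m} (p : Subset m) {q : Subset n} → Nonempty (p ++ᵛ q) → Nonempty p ⊎ Nonempty q
Nonempty-++ᵛ⁻ []      q≢∅                = inj₂ q≢∅
Nonempty-++ᵛ⁻ (_ ∷ p) (zero , here)      = inj₁ (zero , here)
Nonempty-++ᵛ⁻ (_ ∷ p) (suc x , there x∈) with Nonempty-++ᵛ⁻ p (x , x∈)
... | inj₁ (y , y∈p) = inj₁ (suc y , there y∈p)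
... | inj₂ q≢∅       = inj₂ q≢∅

-- Degrees

module _ {a} {A : Set a} (f : A → ℕ) where

  ≤-foldr-⊔ : ∀ {x} e xs → x ∈ᴸ xs → f x ≤ foldr (λ y m → f y ⊔ m) e xs
  ≤-foldr-⊔ e (y ∷ xs) (here refl) = m≤m⊔n (f y) _
  ≤-foldr-⊔ e (y ∷ xs) (there x∈) = ≤-trans (≤-foldr-⊔ e xs x∈) (m≤n⊔m (f y) _)

  foldr-⊔-≤ : ∀ {c} xs → (∀ {x} → x ∈ᴸ xs → f x ≤ c) → foldr (λ y m → f y ⊔ m) 0 xs ≤ c
  foldr-⊔-≤ []       _ = z≤n
  foldr-⊔-≤ (y ∷ xs) h = ⊔-lub (h (here refl)) (foldr-⊔-≤ xs (h ∘ there))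

  foldr-⊓-≤ : ∀ {x} e xs → x ∈ᴸ xs → foldr (λ y m → f y ⊓ m) e xs ≤ f x
  foldr-⊓-≤ e (y ∷ xs) (here refl) = m⊓n≤m (f y) _
  foldr-⊓-≤ e (y ∷ xs) (there x∈) = ≤-trans (m⊓n≤n (f y) _) (foldr-⊓-≤ e xs x∈)

  foldr-⊓-attained : ∀ z xs → ∃ λ x → foldr (λ y m → f y ⊓ m) (f z) xs ≡ f x
  foldr-⊓-attained z [] = z , refl
  foldr-⊓-attained z (y ∷ xs) with ⊓-sel (f y) (foldr (λ y m → f y ⊓ m) (f z) xs)
  ... | inj₁ eq = y , eq
  ... | inj₂ eq = let x , eq′ = foldr-⊓-attained z xs in x , trans eq eq′

degree≤maxDeg : (𝓕 : Family n) (x : Fin n) → degree 𝓕 x ≤ maxDeg 𝓕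
degree≤maxDeg 𝓕 x = ≤-foldr-⊔ (degree 𝓕) 0 (allFin _) (∈-allFin x)

maxDeg≤length : (𝓕 : Family n) → maxDeg 𝓕 ≤ length 𝓕
maxDeg≤length 𝓕 = foldr-⊔-≤ (degree 𝓕) (allFin _) λ {x} _ → length-filter (x ∈?_) 𝓕

minDeg≤degree : (𝓕 : Family n) (x : Fin n) → minDeg 𝓕 ≤ degree 𝓕 x
minDeg≤degree {suc _} 𝓕 x = foldr-⊓-≤ (degree 𝓕) (degree 𝓕 zero) (allFin _) (∈-allFin x)

minDeg-attained : (𝓕 : Family (suc n)) → ∃ λ x → minDeg 𝓕 ≡ degree 𝓕 x
minDeg-attained 𝓕 = foldr-⊓-attained (degree 𝓕) zero (allFin _)

Covers⇒0<degree : {𝓕 : Family n} → Covers 𝓕 → ∀ x → 0 < degree 𝓕 x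
Covers⇒0<degree {𝓕 = 𝓕} covers x with A , A∈𝓕 , x∈A ← covers x =
  filter-some (x ∈?_) (Data.List.Relation.Unary.Any.map (λ { refl → x∈A }) A∈𝓕)

-- The upper bound

module CoverBound {r : ℕ} (𝓡 : Family n) (𝓡-unique : Unique 𝓡) (𝓡-uniform : Uniform r 𝓡)
  (blocker : ∀ {A} S → A ∈ᴸ 𝓡 → S ⊆ A → ∣ S ∣ < r →
    ∃ λ B → ∣ B ∣ ≤ r × Empty (B ∩ S) × (∀ {A′} → A′ ∈ᴸ 𝓡 → Nonempty (A′ ∩ B)))
  where

  over : Subset n → List (Subset n)
  over S = filter (S ⊆?_) 𝓡

  over-unique : ∀ S → Unique (over S)
  over-unique S = filter⁺ (S ⊆?_) 𝓡-unique

  extensions : Subset n → Subset n → List (Subset n)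
  extensions S B = concatMap (λ b → over (S [ b ]≔ inside)) (elements B)

  over⊆extensions : ∀ S {B} → (∀ {A} → A ∈ᴸ 𝓡 → Nonempty (A ∩ B)) → over S ⊆ᴸ extensions S B
  over⊆extensions S {B} meets-B {A} A∈
    with A∈𝓡 , S⊆A ← ∈-filter⁻ (S ⊆?_) A∈
    with b , b∈A∩B ← meets-B A∈𝓡
    with b∈A , b∈B ← x∈p∩q⁻ A B b∈A∩B
    = ∈-concat⁺′ (∈-filter⁺ (S [ b ]≔ inside ⊆?_) A∈𝓡 S[b]⊆A) (∈-map⁺ _ (∈-elements⁺ B b∈B))
    where
    S[b]⊆A : S [ b ]≔ inside ⊆ A
    S[b]⊆A {y} y∈ with y ≟ᶠ b
    ... | yes refl = b∈A
    ... | no  y≢b  = S⊆A (∈-[]≔⁻ S y≢b y∈)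

  length-over≤ : ∀ t S → r ∸ ∣ S ∣ ≡ t → length (over S) ≤ r ^ t
  length-over≤ zero S r∸∣S∣≡0 = Unique⇒length≤ (over-unique S) over⊆[S]
    where
    over⊆[S] : over S ⊆ᴸ [ S ]
    over⊆[S] A∈ with A∈𝓡 , S⊆A ← ∈-filter⁻ (S ⊆?_) A∈ =
      here (⊆∧∣∣≤⇒≡ S⊆A (subst (_≤ ∣ S ∣) (sym (All.lookup 𝓡-uniform A∈𝓡)) (m∸n≡0⇒m≤n r∸∣S∣≡0)))
  length-over≤ (suc t) S r∸∣S∣≡1+t = length≤-from-elements (over S) bound
    where
    bound : ∀ {A} → A ∈ᴸ over S → length (over S) ≤ r ^ suc t
    bound A∈ with A∈𝓡 , S⊆A ← ∈-filter⁻ (S ⊆?_) A∈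
             with B , ∣B∣≤r , B∩S≡∅ , meets-B ← blocker S A∈𝓡 S⊆A (m∸n≢0⇒n<m (1+n≢0 ∘ trans (sym r∸∣S∣≡1+t)))
      = begin
        length (over S)                                    ≤⟨ Unique⇒length≤ (over-unique S) (over⊆extensions S meets-B) ⟩
        length (extensions S B)                            ≤⟨ length-concatMap≤ _ (elements B) extension-bound ⟩
        length (elements B) * r ^ t                        ≡⟨ cong (_* r ^ t) (length-elements B) ⟩
        ∣ B ∣ * r ^ t                                      ≤⟨ *-monoˡ-≤ (r ^ t) ∣B∣≤r ⟩
        r ^ suc t                                          ∎
      where
      open ≤-Reasoning
      extension-bound : ∀ {b} → b ∈ᴸ elements B → length (over (S [ b ]≔ inside)) ≤ r ^ t
      extension-bound {b} b∈ = length-over≤ t (S [ b ]≔ inside) (begin-equality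
        r ∸ ∣ S [ b ]≔ inside ∣   ≡⟨ cong (r ∸_) (∣p[x]≔inside∣≡suc∣p∣ S b∉S) ⟩
        r ∸ suc ∣ S ∣             ≡⟨ pred[m∸n]≡m∸[1+n] r ∣ S ∣ ⟨
        pred (r ∸ ∣ S ∣)          ≡⟨ cong pred r∸∣S∣≡1+t ⟩
        t                         ∎)
        where
        b∉S : b ∉ S
        b∉S b∈S = B∩S≡∅ (b , x∈p∩q⁺ (∈-elements⁻ B b∈ , b∈S))

  length≤r^r : length 𝓡 ≤ r ^ r
  length≤r^r = subst (λ 𝓢 → length 𝓢 ≤ r ^ r) (filter-all (⊥ ⊆?_) {xs = 𝓡} (All.tabulate λ _ → ⊥⊆))
    (length-over≤ r ⊥ (cong (r ∸_) (∣⊥∣≡0 n)))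

_[_↦_] : Subset n → Fin n → Fin n → Subset n
A [ a ↦ x ] = A [ a ]≔ outside [ x ]≔ inside

[↦]-id : (A : Subset n) {x : Fin n} → x ∈ A → A [ x ↦ x ] ≡ A
[↦]-id A {x} x∈A = trans ([]≔-idempotent A x) (p[x]≔inside≡p A x∈A)

[↦]-inverse : (A : Subset n) {a x : Fin n} → a ∈ A → x ∉ A → A [ a ↦ x ] [ x ↦ a ] ≡ A
[↦]-inverse A {a} {x} a∈A x∉A = begin
  A [ a ]≔ outside [ x ]≔ inside [ x ]≔ outside [ a ]≔ inside
    ≡⟨ cong (_[ a ]≔ inside) ([]≔-idempotent (A [ a ]≔ outside) x) ⟩
  A [ a ]≔ outside [ x ]≔ outside [ a ]≔ inside
    ≡⟨ cong (_[ a ]≔ inside) ([]≔-commutes A a x a≢x) ⟩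
  A [ x ]≔ outside [ a ]≔ outside [ a ]≔ inside
    ≡⟨ []≔-idempotent (A [ x ]≔ outside) a ⟩
  A [ x ]≔ outside [ a ]≔ inside
    ≡⟨ cong (_[ a ]≔ inside) (p[x]≔outside≡p A x∉A) ⟩
  A [ a ]≔ inside
    ≡⟨ p[x]≔inside≡p A a∈A ⟩
  A ∎
  where
  open ≡-Reasoning
  a≢x : a ≢ x
  a≢x refl = x∉A a∈A

∣[↦]∣ : (A : Subset n) {a x : Fin n} → a ∈ A → x ∉ A → ∣ A [ a ↦ x ] ∣ ≡ ∣ A ∣
∣[↦]∣ A {a} {x} a∈A x∉A =
  trans (∣p[x]≔inside∣≡suc∣p∣ _ (x∉A ∘ ∈-[]≔⁻ A x≢a)) (suc∣p[x]≔outside∣≡∣p∣ A a∈A)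
  where
  x≢a : x ≢ a
  x≢a refl = x∉A a∈A

module ShiftBound {r : ℕ} (𝓕 : Family n) (𝓕-unique : Unique 𝓕) (𝓕-uniform : Uniform r 𝓕)
  (𝓕-intersecting : Intersecting 𝓕) (𝓕-maximal : Maximal r 𝓕) (x : Fin n) where

  open import Data.List.Membership.DecPropositional (≡-dec {n = n} _≟ᵇ_) using () renaming (_∈?_ to _∈ᴸ?_)

  Shiftable : Subset n → Set
  Shiftable A = ∃ λ a → a ∈ A × A [ a ↦ x ] ∈ᴸ 𝓕

  shiftable? : Decidable Shiftable
  shiftable? A = any? λ a → a ∈? A ×-dec A [ a ↦ x ] ∈ᴸ? 𝓕

  𝓢 𝓡 : Family n
  𝓢 = filter shiftable? 𝓕
  𝓡 = filter (¬? ∘ shiftable?) 𝓕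

  unshifts : Subset n → List (Subset n)
  unshifts B = map (B [ x ↦_]) (allFin n)

  𝓢⊆unshifts : 𝓢 ⊆ᴸ concatMap unshifts (filter (x ∈?_) 𝓕)
  𝓢⊆unshifts {A} A∈𝓢 with A∈𝓕 , (a , a∈A , A[a↦x]∈𝓕) ← ∈-filter⁻ shiftable? {xs = 𝓕} A∈𝓢 | x ∈? A
  ... | yes x∈A = ∈-concat⁺′ (subst (_∈ᴸ unshifts A) ([↦]-id A x∈A) (∈-map⁺ _ (∈-allFin x)))
                             (∈-map⁺ unshifts (∈-filter⁺ (x ∈?_) A∈𝓕 x∈A))
  ... | no  x∉A = ∈-concat⁺′ (subst (_∈ᴸ unshifts (A [ a ↦ x ])) ([↦]-inverse A a∈A x∉A) (∈-map⁺ _ (∈-allFin a)))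
                             (∈-map⁺ unshifts (∈-filter⁺ (x ∈?_) A[a↦x]∈𝓕 ([]≔-updates _ x)))

  length-𝓢≤ : length 𝓢 ≤ degree 𝓕 x * n
  length-𝓢≤ = ≤-trans (Unique⇒length≤ (filter⁺ shiftable? {xs = 𝓕} 𝓕-unique) 𝓢⊆unshifts)
    (length-concatMap≤ unshifts (filter (x ∈?_) 𝓕) λ {B} _ →
      ≤-reflexive (trans (length-map (B [ x ↦_]) (allFin n)) (length-tabulate {n = n} (λ i → i))))

  𝓡-blocker : ∀ {A} S → A ∈ᴸ 𝓡 → S ⊆ A → ∣ S ∣ < r →
    ∃ λ B → ∣ B ∣ ≤ r × Empty (B ∩ S) × (∀ {A′} → A′ ∈ᴸ 𝓡 → Nonempty (A′ ∩ B))
  𝓡-blocker {A} S A∈𝓡 S⊆A ∣S∣<r = blocker-from (∣q∣<∣p∣⇒∃p∖q (subst (∣ S ∣ <_) (sym ∣A∣≡r) ∣S∣<r))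
    where
    A∈𝓕 : A ∈ᴸ 𝓕
    A∈𝓕 = proj₁ (∈-filter⁻ (¬? ∘ shiftable?) {xs = 𝓕} A∈𝓡)
    ¬shiftable : ¬ Shiftable A
    ¬shiftable = proj₂ (∈-filter⁻ (¬? ∘ shiftable?) {xs = 𝓕} A∈𝓡)
    ∣A∣≡r : ∣ A ∣ ≡ r
    ∣A∣≡r = All.lookup 𝓕-uniform A∈𝓕
    x∉A : x ∉ A
    x∉A x∈A = ¬shiftable (x , x∈A , subst (_∈ᴸ 𝓕) (sym ([↦]-id A x∈A)) A∈𝓕)

    blocker-from : (∃ λ a → a ∈ A × a ∉ S) →
      ∃ λ B → ∣ B ∣ ≤ r × Empty (B ∩ S) × (∀ {A′} → A′ ∈ᴸ 𝓡 → Nonempty (A′ ∩ B))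
    blocker-from (a , a∈A , a∉S)
      with B , B∈𝓕 , B∩A[a↦x]≡∅ ← 𝓕-maximal (A [ a ↦ x ]) (trans (∣[↦]∣ A a∈A x∉A) ∣A∣≡r)
                                                   (λ A[a↦x]∈𝓕 → ¬shiftable (a , a∈A , A[a↦x]∈𝓕))
      = B , ≤-reflexive (All.lookup 𝓕-uniform B∈𝓕) , B∩S≡∅
      , λ A′∈𝓡 → 𝓕-intersecting (proj₁ (∈-filter⁻ (¬? ∘ shiftable?) {xs = 𝓕} A′∈𝓡)) B∈𝓕
      where
      S⊆A[a↦x] : S ⊆ A [ a ↦ x ]
      S⊆A[a↦x] {y} y∈S = ⊆-[]≔inside _ x ([]≔-minimal A y a (λ { refl → a∉S y∈S }) (S⊆A y∈S))
      B∩S≡∅ : Empty (B ∩ S)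
      B∩S≡∅ (y , y∈B∩S) with y∈B , y∈S ← x∈p∩q⁻ B S y∈B∩S =
        B∩A[a↦x]≡∅ (y , x∈p∩q⁺ (y∈B , S⊆A[a↦x] y∈S))

  𝓡-unique : Unique 𝓡
  𝓡-unique = filter⁺ (¬? ∘ shiftable?) {xs = 𝓕} 𝓕-unique

  𝓡-uniform : Uniform r 𝓡
  𝓡-uniform = All.filter⁺ (¬? ∘ shiftable?) 𝓕-uniform

  length-𝓕≤ : length 𝓕 ≤ degree 𝓕 x * n + r ^ r
  length-𝓕≤ = begin
    length 𝓕             ≡⟨ length-filter+filter-∁ shiftable? 𝓕 ⟨
    length 𝓢 + length 𝓡  ≤⟨ +-mono-≤ length-𝓢≤ (CoverBound.length≤r^r 𝓡 𝓡-unique 𝓡-uniform 𝓡-blocker) ⟩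
    degree 𝓕 x * n + r ^ r ∎
    where open ≤-Reasoning

maxDeg≤[n+r^r]*minDeg : ∀ {n r} (𝓕 : Family n) → Admissible n r 𝓕 → maxDeg 𝓕 ≤ (n + r ^ r) * minDeg 𝓕
maxDeg≤[n+r^r]*minDeg {zero} 𝓕 _ = z≤n
maxDeg≤[n+r^r]*minDeg {suc n} {r} 𝓕 (unique , uniform , intersecting , maximal , covers)
  with x , minDeg≡degree ← minDeg-attained 𝓕 = begin
  maxDeg 𝓕                        ≤⟨ maxDeg≤length 𝓕 ⟩
  length 𝓕                        ≤⟨ ShiftBound.length-𝓕≤ 𝓕 unique uniform intersecting maximal x ⟩
  d * suc n + r ^ r               ≤⟨ +-monoʳ-≤ (d * suc n) (m≤m*n (r ^ r) d) ⟩
  d * suc n + r ^ r * d           ≡⟨ cong (_+ r ^ r * d) (*-comm d (suc n)) ⟩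
  suc n * d + r ^ r * d           ≡⟨ *-distribʳ-+ d (suc n) (r ^ r) ⟨
  (suc n + r ^ r) * d             ≡⟨ cong ((suc n + r ^ r) *_) minDeg≡degree ⟨
  (suc n + r ^ r) * minDeg 𝓕      ∎
  where
  open ≤-Reasoning
  d : ℕ
  d = degree 𝓕 x
  instance
    d≢0 : NonZero d
    d≢0 = >-nonZero (Covers⇒0<degree covers x)

-- The lower bound

LowerBoundFamily : ℕ → ℕ → Set
LowerBoundFamily n r = Σ (Family n) λ 𝓕 → Admissible n r 𝓕 ×
  ((n ∸ 2 * r + 3) * ((2 * r ∸ 3) C (r ∸ 2)) * minDeg 𝓕
    ≤ maxDeg 𝓕 * ((2 * r ∸ 3) C (r ∸ 2)) + (n ∸ 2 * r + 2) * minDeg 𝓕)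

-- The extremal family on [n] = Z ∪ {y} ∪ W, with |Z| = 2r − 3, |W| = n − 2r + 2 and a fixed
-- (r − 1)-set S₀ ⊆ Z (here r = s + 2, n = 2r + t); ⟨ z , b , W′ ⟩ encodes z ∪ W′, plus y if b:
--   𝓐 = {z ∪ {y} : |z| = r − 1},     𝓑 = {z ∪ {y, w} : |z| = r − 2, z ≠ Z ∖ S₀},
--   𝓒 = {S₀ ∪ {w}},                  𝓓 = {z : |z| = r}          (z ⊆ Z, w ∈ W).
module Construction (s t : ℕ) where

  m k N r : ℕ
  m = suc (s + s)
  k = 2 + t
  N = m + suc k
  r = 2 + s

  ⟨_,_,_⟩ : Subset m → Side → Subset k → Subset N
  ⟨ z , b , W ⟩ = z ++ᵛ (b ∷ W)

  y : Fin N
  y = m ↑ʳ zero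

  w⃗ : Fin k → Fin N
  w⃗ w = m ↑ʳ suc w

  -- Abstract, so that unification never unfolds S₀ inside ⟨_,_,_⟩.
  abstract
    S₀ : Subset m
    S₀ = ⊤ {suc s} ++ᵛ ⊥ {s}

    ∣S₀∣ : ∣ S₀ ∣ ≡ suc s
    ∣S₀∣ = trans (∣++ᵛ∣ (⊤ {suc s}) (⊥ {s})) (trans (cong₂ _+_ (∣⊤∣≡n (suc s)) (∣⊥∣≡0 s)) (+-identityʳ (suc s)))

  _≟ˢ_ : DecidableEquality (Subset m)
  _≟ˢ_ = ≡-dec _≟ᵇ_

  𝓩 : List (Subset m)
  𝓩 = filter (λ z → ¬? (z ≟ˢ ∁ S₀)) (choose m s)

  𝓐 𝓑 𝓒 𝓓 𝓕 : Family N
  𝓐 = map (λ z → ⟨ z , inside , ⊥ ⟩) (choose m (suc s))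
  𝓑 = cartesianProductWith (λ w z → ⟨ z , inside , ⁅ w ⁆ ⟩) (allFin k) 𝓩
  𝓒 = map (λ w → ⟨ S₀ , outside , ⁅ w ⁆ ⟩) (allFin k)
  𝓓 = map (λ z → ⟨ z , outside , ⊥ ⟩) (choose m (suc (suc s)))
  𝓕 = (𝓐 ++ 𝓑) ++ (𝓒 ++ 𝓓)

  data Member : Subset N → Set where
    𝓐-member : ∀ {z} → ∣ z ∣ ≡ suc s → Member ⟨ z , inside , ⊥ ⟩
    𝓑-member : ∀ {z} w → ∣ z ∣ ≡ s → z ≢ ∁ S₀ → Member ⟨ z , inside , ⁅ w ⁆ ⟩
    𝓒-member : ∀ w → Member ⟨ S₀ , outside , ⁅ w ⁆ ⟩
    𝓓-member : ∀ {z} → ∣ z ∣ ≡ suc (suc s) → Member ⟨ z , outside , ⊥ ⟩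

  ∈𝓩⁻ : ∀ {z} → z ∈ᴸ 𝓩 → ∣ z ∣ ≡ s × z ≢ ∁ S₀
  ∈𝓩⁻ z∈ = let z∈choose , z≢∁S₀ = ∈-filter⁻ (λ z → ¬? (z ≟ˢ ∁ S₀)) {xs = choose m s} z∈ in
    ∈-choose⁻ m s z∈choose , z≢∁S₀

  member⁻ : ∀ {A} → A ∈ᴸ 𝓕 → Member A
  member⁻ A∈ with ∈-++⁻ (𝓐 ++ 𝓑) A∈
  ... | inj₁ A∈𝓐𝓑 with ∈-++⁻ 𝓐 A∈𝓐𝓑
  ...   | inj₁ A∈𝓐 with z , z∈ , refl ← ∈-map⁻ (λ z → ⟨ z , inside , ⊥ ⟩) A∈𝓐 =
    𝓐-member (∈-choose⁻ m (suc s) z∈)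
  ...   | inj₂ A∈𝓑
    with w , z , _ , z∈𝓩 , refl ← ∈-cartesianProductWith⁻ (λ w z → ⟨ z , inside , ⁅ w ⁆ ⟩) (allFin k) 𝓩 A∈𝓑 =
    𝓑-member w (proj₁ (∈𝓩⁻ z∈𝓩)) (proj₂ (∈𝓩⁻ z∈𝓩))
  member⁻ A∈ | inj₂ A∈𝓒𝓓 with ∈-++⁻ 𝓒 A∈𝓒𝓓
  ...   | inj₁ A∈𝓒 with w , _ , refl ← ∈-map⁻ (λ w → ⟨ S₀ , outside , ⁅ w ⁆ ⟩) {xs = allFin k} A∈𝓒 =
    𝓒-member w
  ...   | inj₂ A∈𝓓 with z , z∈ , refl ← ∈-map⁻ (λ z → ⟨ z , outside , ⊥ ⟩) A∈𝓓 =
    𝓓-member (∈-choose⁻ m (suc (suc s)) z∈)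

  member⁺ : ∀ {A} → Member A → A ∈ᴸ 𝓕
  member⁺ (𝓐-member {z} ∣z∣≡1+s) =
    ∈-++⁺ˡ (∈-++⁺ˡ (∈-map⁺ (λ z → ⟨ z , inside , ⊥ ⟩) (∈-choose⁺ z ∣z∣≡1+s)))
  member⁺ (𝓑-member {z} w ∣z∣≡s z≢∁S₀) =
    ∈-++⁺ˡ (∈-++⁺ʳ 𝓐 (∈-cartesianProductWith⁺ (λ w z → ⟨ z , inside , ⁅ w ⁆ ⟩) (∈-allFin w)
      (∈-filter⁺ (λ z → ¬? (z ≟ˢ ∁ S₀)) (∈-choose⁺ z ∣z∣≡s) z≢∁S₀)))
  member⁺ (𝓒-member w) =
    ∈-++⁺ʳ (𝓐 ++ 𝓑) (∈-++⁺ˡ (∈-map⁺ (λ w → ⟨ S₀ , outside , ⁅ w ⁆ ⟩) (∈-allFin w)))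
  member⁺ (𝓓-member {z} ∣z∣≡2+s) =
    ∈-++⁺ʳ (𝓐 ++ 𝓑) (∈-++⁺ʳ 𝓒 (∈-map⁺ (λ z → ⟨ z , outside , ⊥ ⟩) (∈-choose⁺ z ∣z∣≡2+s)))

  ∣⟨⟩∣ : ∀ z b W → ∣ ⟨ z , b , W ⟩ ∣ ≡ ∣ z ∣ + ∣ b ∷ W ∣
  ∣⟨⟩∣ z b W = ∣++ᵛ∣ z (b ∷ W)

  ⟨⟩∩⟨⟩ : ∀ z b W z′ b′ W′ → ⟨ z , b , W ⟩ ∩ ⟨ z′ , b′ , W′ ⟩ ≡ ⟨ z ∩ z′ , b ∧ b′ , W ∩ W′ ⟩
  ⟨⟩∩⟨⟩ z b W z′ b′ W′ = zipWith-++ _∧_ z (b ∷ W) z′ (b′ ∷ W′)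

  meet-at-y : ∀ {z W z′ W′} → Nonempty (⟨ z , inside , W ⟩ ∩ ⟨ z′ , inside , W′ ⟩)
  meet-at-y {z} {W} {z′} {W′} =
    y , subst (y ∈_) (sym (⟨⟩∩⟨⟩ z inside W z′ inside W′)) (∈-++ᵛ⁺ʳ (z ∩ z′) here)

  meet-in-Z : ∀ {z b W z′ b′ W′} → Nonempty (z ∩ z′) → Nonempty (⟨ z , b , W ⟩ ∩ ⟨ z′ , b′ , W′ ⟩)
  meet-in-Z {z} {b} {W} {z′} {b′} {W′} (x , x∈) =
    x ↑ˡ suc k , subst (x ↑ˡ suc k ∈_) (sym (⟨⟩∩⟨⟩ z b W z′ b′ W′)) (∈-++ᵛ⁺ˡ x∈)

  meet-big : ∀ {z b W z′ b′ W′} → suc s ≤ ∣ z ∣ → suc s ≤ ∣ z′ ∣ →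
    Nonempty (⟨ z , b , W ⟩ ∩ ⟨ z′ , b′ , W′ ⟩)
  meet-big {z} {z′ = z′} 1+s≤∣z∣ 1+s≤∣z′∣ = meet-in-Z (Nonempty-∩ z z′
    (subst (_≤ ∣ z ∣ + ∣ z′ ∣) (cong suc (+-suc s s)) (+-mono-≤ 1+s≤∣z∣ 1+s≤∣z′∣)))

  disjoint : ∀ {z b W z′ b′ W′} → Empty (z ∩ z′) → b ∧ b′ ≡ outside → Empty (W ∩ W′) →
    Empty (⟨ z , b , W ⟩ ∩ ⟨ z′ , b′ , W′ ⟩)
  disjoint {z} {b} {W} {z′} {b′} {W′} z∩z′≡∅ b∧b′≡outside W∩W′≡∅ (x , x∈)
    with Nonempty-++ᵛ⁻ (z ∩ z′) (x , subst (x ∈_) (⟨⟩∩⟨⟩ z b W z′ b′ W′) x∈)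
  ... | inj₁ z∩z′≢∅                 = z∩z′≡∅ z∩z′≢∅
  ... | inj₂ (zero , y∈)            = contradiction (trans (sym ([]=⇒lookup y∈)) b∧b′≡outside) λ ()
  ... | inj₂ (suc w , there w∈W∩W′) = W∩W′≡∅ (w , w∈W∩W′)

  ∣∁S₀∣ : ∣ ∁ S₀ ∣ ≡ s
  ∣∁S₀∣ = trans (∣∁p∣≡n∸∣p∣ S₀) (trans (cong (m ∸_) ∣S₀∣) (m+n∸n≡m s s))

  meets-S₀ : ∀ {z} → ∣ z ∣ ≡ s → z ≢ ∁ S₀ → Nonempty (z ∩ S₀)
  meets-S₀ {z} ∣z∣≡s z≢∁S₀ with nonempty? (z ∩ S₀)
  ... | yes z∩S₀≢∅ = z∩S₀≢∅
  ... | no  z∩S₀≡∅ =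
    contradiction (sym (⊆∧∣∣≤⇒≡ (Empty-∩⇒⊆∁ z∩S₀≡∅) (≤-reflexive (trans ∣∁S₀∣ (sym ∣z∣≡s))))) z≢∁S₀

  uniform : Uniform r 𝓕
  uniform = All.tabulate (size ∘ member⁻)
    where
    size : ∀ {A} → Member A → ∣ A ∣ ≡ r
    size (𝓐-member {z} e)       = trans (∣⟨⟩∣ z inside ⊥) (trans (cong₂ _+_ e (cong suc (∣⊥∣≡0 k))) (+-comm (suc s) 1))
    size (𝓑-member {z} w e _)   = trans (∣⟨⟩∣ z inside ⁅ w ⁆) (trans (cong₂ _+_ e (cong suc (∣⁅x⁆∣≡1 w))) (+-comm s 2))
    size (𝓒-member w)           = trans (∣⟨⟩∣ S₀ outside ⁅ w ⁆) (trans (cong₂ _+_ ∣S₀∣ (∣⁅x⁆∣≡1 w)) (+-comm (suc s) 1))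
    size (𝓓-member {z} e)       = trans (∣⟨⟩∣ z outside ⊥) (trans (cong₂ _+_ e (∣⊥∣≡0 k)) (+-identityʳ r))

  intersecting : Intersecting 𝓕
  intersecting A∈ B∈ = meet (member⁻ A∈) (member⁻ B∈)
    where
    ∣S₀∣≥ : suc s ≤ ∣ S₀ ∣
    ∣S₀∣≥ = ≤-reflexive (sym ∣S₀∣)
    ≥-𝓐 : ∀ {a} → a ≡ suc s → suc s ≤ a
    ≥-𝓐 e = ≤-reflexive (sym e)
    ≥-𝓓 : ∀ {a} → a ≡ suc (suc s) → suc s ≤ a
    ≥-𝓓 e = ≤-trans (n≤1+n _) (≤-reflexive (sym e))

    meet : ∀ {A B} → Member A → Member B → Nonempty (A ∩ B)
    meet (𝓐-member _)       (𝓐-member _)       = meet-at-y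
    meet (𝓐-member _)       (𝓑-member _ _ _)   = meet-at-y
    meet (𝓑-member _ _ _)   (𝓐-member _)       = meet-at-y
    meet (𝓑-member _ _ _)   (𝓑-member _ _ _)   = meet-at-y
    meet (𝓑-member _ e z≢)  (𝓒-member _)       = meet-in-Z (meets-S₀ e z≢)
    meet (𝓑-member {z} _ e _) (𝓓-member {z′} e′) = meet-in-Z (Nonempty-∩ z z′ (≤-reflexive (begin
      suc m             ≡⟨ cong suc (+-suc s s) ⟨
      suc (s + suc s)   ≡⟨ +-suc s (suc s) ⟨
      s + suc (suc s)   ≡⟨ cong₂ _+_ e e′ ⟨
      ∣ z ∣ + ∣ z′ ∣    ∎)))
      where open ≡-Reasoning
    meet (𝓒-member w)       b@(𝓑-member _ _ _) = Nonempty-∩-comm (meet b (𝓒-member w))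
    meet a@(𝓓-member _)     b@(𝓑-member _ _ _) = Nonempty-∩-comm (meet b a)
    meet (𝓐-member e)       (𝓒-member _)       = meet-big (≥-𝓐 e) ∣S₀∣≥
    meet (𝓐-member e)       (𝓓-member e′)      = meet-big (≥-𝓐 e) (≥-𝓓 e′)
    meet (𝓒-member _)       (𝓐-member e)       = meet-big ∣S₀∣≥ (≥-𝓐 e)
    meet (𝓒-member _)       (𝓒-member _)       = meet-big ∣S₀∣≥ ∣S₀∣≥
    meet (𝓒-member _)       (𝓓-member e)       = meet-big ∣S₀∣≥ (≥-𝓓 e)
    meet (𝓓-member e)       (𝓐-member e′)      = meet-big (≥-𝓓 e) (≥-𝓐 e′)
    meet (𝓓-member e)       (𝓒-member _)       = meet-big (≥-𝓓 e) ∣S₀∣≥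
    meet (𝓓-member e)       (𝓓-member e′)      = meet-big (≥-𝓓 e) (≥-𝓓 e′)

  covers : Covers 𝓕
  covers x with splitAt m x in eq
  ... | inj₁ j
    with q , q⊆∁⁅j⁆ , ∣q∣≡s ← ⊆∁-of-size ⁅ j ⁆ (subst (λ c → c + s ≤ m) (sym (∣⁅x⁆∣≡1 j)) (s≤s (m≤m+n s s))) =
    ⟨ q [ j ]≔ inside , inside , ⊥ ⟩ ,
    member⁺ (𝓐-member (trans (∣p[x]≔inside∣≡suc∣p∣ q j∉q) (cong suc ∣q∣≡s))) ,
    subst (_∈ ⟨ q [ j ]≔ inside , inside , ⊥ ⟩) (splitAt⁻¹-↑ˡ eq) (∈-++ᵛ⁺ˡ ([]≔-updates q j))
    where
    j∉q : j ∉ q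
    j∉q j∈q = x∈∁p⇒x∉p (q⊆∁⁅j⁆ j∈q) (x∈⁅x⁆ j)
  ... | inj₂ zero    = ⟨ S₀ , inside , ⊥ ⟩ , member⁺ (𝓐-member ∣S₀∣) ,
    subst (_∈ ⟨ S₀ , inside , ⊥ ⟩) (splitAt⁻¹-↑ʳ eq) (∈-++ᵛ⁺ʳ S₀ here)
  ... | inj₂ (suc w) = ⟨ S₀ , outside , ⁅ w ⁆ ⟩ , member⁺ (𝓒-member w) ,
    subst (_∈ ⟨ S₀ , outside , ⁅ w ⁆ ⟩) (splitAt⁻¹-↑ʳ eq) (∈-++ᵛ⁺ʳ S₀ (there (x∈⁅x⁆ w)))

  another : Fin k → Fin k
  another zero    = suc zero
  another (suc _) = zero

  another≢ : ∀ w → another w ≢ w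
  another≢ zero    ()
  another≢ (suc _) ()

  <s⇒+2+s≤m : ∀ {a} → a < s → a + suc (suc s) ≤ m
  <s⇒+2+s≤m {a} a<s = subst (_≤ m) (sym (trans (+-suc a (suc s)) (cong suc (+-suc a s)))) (s≤s (+-monoˡ-≤ s a<s))

  <1+s⇒+1+s≤m : ∀ {a} → a < suc s → a + suc s ≤ m
  <1+s⇒+1+s≤m {a} a<1+s = subst (_≤ m) (sym (+-suc a s)) (s≤s (+-monoˡ-≤ s (≤-pred a<1+s)))

  disjoint-member-y : ∀ g W → ∣ g ∣ + ∣ W ∣ ≡ suc s → ¬ Member ⟨ g , inside , W ⟩ →
    ∃ λ A → Member A × Empty (A ∩ ⟨ g , inside , W ⟩)
  disjoint-member-y g W ∣g∣+∣W∣≡1+s ¬member with <-cmp ∣ g ∣ s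
  ... | tri< ∣g∣<s _ _ with q , q⊆∁g , ∣q∣≡2+s ← ⊆∁-of-size g (<s⇒+2+s≤m ∣g∣<s) =
    ⟨ q , outside , ⊥ ⟩ , 𝓓-member ∣q∣≡2+s , disjoint (⊆∁⇒Empty-∩ q⊆∁g) refl (Empty-⊥∩ W)
  ... | tri≈ _ ∣g∣≡s _ with w , refl ← ∣p∣≡1⇒p≡⁅x⁆ W (m≡o∧m+n≡1+o⇒n≡1 ∣g∣≡s ∣g∣+∣W∣≡1+s)
                        with g ≟ˢ ∁ S₀
  ...   | yes refl = ⟨ S₀ , outside , ⁅ another w ⁆ ⟩ , 𝓒-member (another w) ,
                     disjoint (Empty-∩-∁ S₀) refl (Empty-⁅⁆∩⁅⁆ (another≢ w))
  ...   | no  g≢∁S₀ = contradiction (𝓑-member w ∣g∣≡s g≢∁S₀) ¬member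
  disjoint-member-y g W ∣g∣+∣W∣≡1+s ¬member | tri> _ _ s<∣g∣
    with ∣g∣≡1+s , ∣W∣≡0 ← m+n≡o∧o≤m⇒m≡o∧n≡0 ∣ g ∣ ∣g∣+∣W∣≡1+s s<∣g∣
    with refl ← ∣p∣≡0⇒p≡⊥ W ∣W∣≡0 = contradiction (𝓐-member ∣g∣≡1+s) ¬member

  disjoint-member-¬y : ∀ g W → ∣ g ∣ + ∣ W ∣ ≡ suc (suc s) → ¬ Member ⟨ g , outside , W ⟩ →
    ∃ λ A → Member A × Empty (A ∩ ⟨ g , outside , W ⟩)
  disjoint-member-¬y g W ∣g∣+∣W∣≡2+s ¬member with <-cmp ∣ g ∣ (suc s)
  ... | tri< ∣g∣<1+s _ _ with q , q⊆∁g , ∣q∣≡1+s ← ⊆∁-of-size g (<1+s⇒+1+s≤m ∣g∣<1+s) =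
    ⟨ q , inside , ⊥ ⟩ , 𝓐-member ∣q∣≡1+s , disjoint (⊆∁⇒Empty-∩ q⊆∁g) refl (Empty-⊥∩ W)
  ... | tri≈ _ ∣g∣≡1+s _ with w , refl ← ∣p∣≡1⇒p≡⁅x⁆ W (m≡o∧m+n≡1+o⇒n≡1 ∣g∣≡1+s ∣g∣+∣W∣≡2+s)
                          with g ≟ˢ S₀
  ...   | yes refl = contradiction (𝓒-member w) ¬member
  ...   | no  g≢S₀ = ⟨ ∁ g , inside , ⁅ another w ⁆ ⟩ , 𝓑-member (another w) ∣∁g∣≡s (g≢S₀ ∘ ∁-injective) ,
                     disjoint (⊆∁⇒Empty-∩ (λ x∈ → x∈)) refl (Empty-⁅⁆∩⁅⁆ (another≢ w))
    where
    ∣∁g∣≡s : ∣ ∁ g ∣ ≡ s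
    ∣∁g∣≡s = trans (∣∁p∣≡n∸∣p∣ g) (trans (cong (m ∸_) ∣g∣≡1+s) (m+n∸n≡m s s))
  disjoint-member-¬y g W ∣g∣+∣W∣≡2+s ¬member | tri> _ _ 1+s<∣g∣
    with ∣g∣≡2+s , ∣W∣≡0 ← m+n≡o∧o≤m⇒m≡o∧n≡0 ∣ g ∣ ∣g∣+∣W∣≡2+s 1+s<∣g∣
    with refl ← ∣p∣≡0⇒p≡⊥ W ∣W∣≡0 = contradiction (𝓓-member ∣g∣≡2+s) ¬member

  disjoint-member : ∀ g b W → ∣ g ∣ + ∣ b ∷ W ∣ ≡ r → ¬ Member ⟨ g , b , W ⟩ →
    ∃ λ A → Member A × Empty (A ∩ ⟨ g , b , W ⟩)
  disjoint-member g inside  W eq = disjoint-member-y g W (suc-injective (trans (sym (+-suc ∣ g ∣ ∣ W ∣)) eq))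
  disjoint-member g outside W eq = disjoint-member-¬y g W eq

  maximal : Maximal r 𝓕
  maximal G ∣G∣≡r G∉𝓕 with g , b ∷ W , refl ← splitAtᵛ m G
                       with A , A-member , A∩G≡∅ ← disjoint-member g b W (trans (sym (∣⟨⟩∣ g b W)) ∣G∣≡r) (G∉𝓕 ∘ member⁺)
    = A , member⁺ A-member , A∩G≡∅

  ⟨⟩-injective : ∀ {z b W z′ b′ W′} → ⟨ z , b , W ⟩ ≡ ⟨ z′ , b′ , W′ ⟩ → z ≡ z′ × b ≡ b′ × W ≡ W′
  ⟨⟩-injective {z} {z′ = z′} eq = let z≡z′ , b∷W≡b′∷W′ = ++-injective z z′ eq in z≡z′ , ∷-injective b∷W≡b′∷W′

  y∈⟨⟩ : ∀ z W → y ∈ ⟨ z , inside , W ⟩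
  y∈⟨⟩ z W = ∈-++ᵛ⁺ʳ z here

  y∉⟨⟩ : ∀ z W → y ∉ ⟨ z , outside , W ⟩
  y∉⟨⟩ z W y∈ with () ← ∈-++ᵛ⁻ʳ z y∈

  w⃗∈⟨⟩⁻ : ∀ z b W {w} → w⃗ w ∈ ⟨ z , b , W ⟩ → w ∈ W
  w⃗∈⟨⟩⁻ z b W w∈ = drop-there (∈-++ᵛ⁻ʳ z w∈)

  HitsW : Subset N → Set
  HitsW A = ∃ λ w → w⃗ w ∈ A

  hitsW : ∀ z b w → HitsW ⟨ z , b , ⁅ w ⁆ ⟩
  hitsW z b w = w , ∈-++ᵛ⁺ʳ z (there (x∈⁅x⁆ w))

  ¬hitsW : ∀ z b → ¬ HitsW ⟨ z , b , ⊥ ⟩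
  ¬hitsW z b (w , w∈) = ∉⊥ (w⃗∈⟨⟩⁻ z b ⊥ w∈)

  module _ {p} {P : Pred (Subset N) p} where

    All-𝓐 : (∀ z → P ⟨ z , inside , ⊥ ⟩) → All P 𝓐
    All-𝓐 h = All.map⁺ (All.tabulate λ {z} _ → h z)

    All-𝓑 : (∀ w z → P ⟨ z , inside , ⁅ w ⁆ ⟩) → All P 𝓑
    All-𝓑 h = All.tabulate λ A∈ →
      let w , z , _ , _ , A≡ = ∈-cartesianProductWith⁻ (λ w z → ⟨ z , inside , ⁅ w ⁆ ⟩) (allFin k) 𝓩 A∈
      in subst P (sym A≡) (h w z)

    All-𝓒 : (∀ w → P ⟨ S₀ , outside , ⁅ w ⁆ ⟩) → All P 𝓒
    All-𝓒 h = All.map⁺ (All.tabulate {xs = allFin k} λ {w} _ → h w)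

    All-𝓓 : (∀ z → P ⟨ z , outside , ⊥ ⟩) → All P 𝓓
    All-𝓓 h = All.map⁺ (All.tabulate λ {z} _ → h z)

  𝓐-unique : Unique 𝓐
  𝓐-unique = Unique.map⁺ (proj₁ ∘ ⟨⟩-injective) (choose-unique m (suc s))

  𝓑-unique : Unique 𝓑
  𝓑-unique = Unique.cartesianProductWith⁺ (λ w z → ⟨ z , inside , ⁅ w ⁆ ⟩)
    (λ eq → let z≡z′ , _ , ⁅w⁆≡⁅w′⁆ = ⟨⟩-injective eq in ⁅⁆-injective ⁅w⁆≡⁅w′⁆ , z≡z′)
    (Unique.allFin⁺ k) (filter⁺ (λ z → ¬? (z ≟ˢ ∁ S₀)) (choose-unique m s))

  𝓐𝓑-unique : Unique (𝓐 ++ 𝓑)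
  𝓐𝓑-unique = Unique-++ {P = ¬_ ∘ HitsW} 𝓐-unique 𝓑-unique
    (All-𝓐 λ z → ¬hitsW z inside) (All-𝓑 λ w z ¬hits → ¬hits (hitsW z inside w))

  y∈𝓐𝓑 : All (y ∈_) (𝓐 ++ 𝓑)
  y∈𝓐𝓑 = All.++⁺ (All-𝓐 λ z → y∈⟨⟩ z ⊥) (All-𝓑 λ w z → y∈⟨⟩ z ⁅ w ⁆)

  unique : Unique 𝓕
  unique = Unique-++ {P = y ∈_} 𝓐𝓑-unique 𝓒𝓓-unique y∈𝓐𝓑
    (All.++⁺ (All-𝓒 λ w → y∉⟨⟩ S₀ ⁅ w ⁆) (All-𝓓 λ z → y∉⟨⟩ z ⊥))
    where
    𝓒𝓓-unique : Unique (𝓒 ++ 𝓓)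
    𝓒𝓓-unique = Unique-++ {P = HitsW}
      (Unique.map⁺ (⁅⁆-injective ∘ proj₂ ∘ proj₂ ∘ ⟨⟩-injective) (Unique.allFin⁺ k))
      (Unique.map⁺ (proj₁ ∘ ⟨⟩-injective) (choose-unique m (suc (suc s))))
      (All-𝓒 λ w → hitsW S₀ outside w) (All-𝓓 λ z → ¬hitsW z outside)

  admissible : Admissible N r 𝓕
  admissible = unique , uniform , intersecting , maximal , covers

  mCs : ℕ
  mCs = m C s

  suc-length-𝓩 : suc (length 𝓩) ≡ mCs
  suc-length-𝓩 = trans (length-filter-≢ _≟ˢ_ (choose-unique m s) (∈-choose⁺ (∁ S₀) ∣∁S₀∣)) (length-choose m s)

  length-𝓐 : length 𝓐 ≡ mCs
  length-𝓐 = begin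
    length 𝓐                   ≡⟨ length-map (λ z → ⟨ z , inside , ⊥ ⟩) (choose m (suc s)) ⟩
    length (choose m (suc s))  ≡⟨ length-choose m (suc s) ⟩
    m C suc s                  ≡⟨ nCk≡nC[n∸k] (s≤s (m≤n+m s s)) ⟩
    m C (s + s ∸ s)            ≡⟨ cong (m C_) (m+n∸n≡m s s) ⟩
    mCs                        ∎
    where open ≡-Reasoning

  mCs+k*length-𝓩≤degree-y : mCs + k * length 𝓩 ≤ degree 𝓕 y
  mCs+k*length-𝓩≤degree-y = begin
    mCs + k * length 𝓩     ≡⟨ cong₂ _+_ length-𝓐 length-𝓑 ⟨
    length 𝓐 + length 𝓑    ≡⟨ length-++ 𝓐 ⟨
    length (𝓐 ++ 𝓑)        ≤⟨ Unique⇒length≤ 𝓐𝓑-unique 𝓐𝓑⊆ ⟩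
    degree 𝓕 y             ∎
    where
    open ≤-Reasoning
    length-𝓑 : length 𝓑 ≡ k * length 𝓩
    length-𝓑 = trans (length-cartesianProductWith _ (allFin k) 𝓩) (cong (_* length 𝓩) (length-tabulate {n = k} (λ i → i)))
    𝓐𝓑⊆ : 𝓐 ++ 𝓑 ⊆ᴸ filter (y ∈?_) 𝓕
    𝓐𝓑⊆ A∈ = ∈-filter⁺ (y ∈?_) (∈-++⁺ˡ A∈) (All.lookup y∈𝓐𝓑 A∈)

  degree-w⃗≤mCs : ∀ w → degree 𝓕 (w⃗ w) ≤ mCs
  degree-w⃗≤mCs w = begin
    degree 𝓕 (w⃗ w)                                        ≤⟨ Unique⇒length≤ (filter⁺ (w⃗ w ∈?_) unique) ⊆𝓒𝓑 ⟩
    suc (length (map (λ z → ⟨ z , inside , ⁅ w ⁆ ⟩) 𝓩))   ≡⟨ cong suc (length-map _ 𝓩) ⟩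
    suc (length 𝓩)                                        ≡⟨ suc-length-𝓩 ⟩
    mCs                                                   ∎
    where
    open ≤-Reasoning
    through-w : ∀ {A} → Member A → w⃗ w ∈ A → A ∈ᴸ ⟨ S₀ , outside , ⁅ w ⁆ ⟩ ∷ map (λ z → ⟨ z , inside , ⁅ w ⁆ ⟩) 𝓩
    through-w (𝓐-member {z} _)          w∈ = contradiction (w⃗∈⟨⟩⁻ z inside ⊥ w∈) ∉⊥
    through-w (𝓑-member {z} w′ e z≢∁S₀) w∈ with refl ← x∈⁅y⁆⇒x≡y w′ (w⃗∈⟨⟩⁻ z inside ⁅ w′ ⁆ w∈) =
      there (∈-map⁺ _ (∈-filter⁺ (λ z → ¬? (z ≟ˢ ∁ S₀)) (∈-choose⁺ z e) z≢∁S₀))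
    through-w (𝓒-member w′)             w∈ with refl ← x∈⁅y⁆⇒x≡y w′ (w⃗∈⟨⟩⁻ S₀ outside ⁅ w′ ⁆ w∈) = here refl
    through-w (𝓓-member {z} _)          w∈ = contradiction (w⃗∈⟨⟩⁻ z outside ⊥ w∈) ∉⊥
    ⊆𝓒𝓑 : filter (w⃗ w ∈?_) 𝓕 ⊆ᴸ ⟨ S₀ , outside , ⁅ w ⁆ ⟩ ∷ map (λ z → ⟨ z , inside , ⁅ w ⁆ ⟩) 𝓩
    ⊆𝓒𝓑 A∈ = let A∈𝓕 , w∈A = ∈-filter⁻ (w⃗ w ∈?_) {xs = 𝓕} A∈ in through-w (member⁻ A∈𝓕) w∈A

  [1+k]*mCs≤maxDeg+k : suc k * mCs ≤ maxDeg 𝓕 + k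
  [1+k]*mCs≤maxDeg+k = begin
    mCs + k * mCs              ≡⟨ cong (λ c → mCs + k * c) suc-length-𝓩 ⟨
    mCs + k * suc (length 𝓩)   ≡⟨ cong (mCs +_) (trans (*-suc k (length 𝓩)) (+-comm k _)) ⟩
    mCs + (k * length 𝓩 + k)   ≡⟨ +-assoc mCs _ k ⟨
    mCs + k * length 𝓩 + k     ≤⟨ +-monoˡ-≤ k (≤-trans mCs+k*length-𝓩≤degree-y (degree≤maxDeg 𝓕 y)) ⟩
    maxDeg 𝓕 + k               ∎
    where open ≤-Reasoning

  minDeg≤mCs : minDeg 𝓕 ≤ mCs
  minDeg≤mCs = ≤-trans (minDeg≤degree 𝓕 (w⃗ zero)) (degree-w⃗≤mCs zero)

  N≡2*r+t : N ≡ 2 * r + t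
  N≡2*r+t = solve 2 (λ s t → (con 1 :+ s :+ s) :+ (con 3 :+ t) := con 2 :* (con 2 :+ s) :+ t) refl s t

  2*r∸3≡m : 2 * r ∸ 3 ≡ m
  2*r∸3≡m = trans (cong (_∸ 3) (solve 1 (λ s → con 2 :* (con 2 :+ s) := (con 1 :+ s :+ s) :+ con 3) refl s)) (m+n∸n≡m m 3)

  ratio-bound : (t + 3) * mCs * minDeg 𝓕 ≤ maxDeg 𝓕 * mCs + (t + 2) * minDeg 𝓕
  ratio-bound = subst₂ (λ a b → a * mCs * minDeg 𝓕 ≤ maxDeg 𝓕 * mCs + b * minDeg 𝓕) (+-comm 3 t) (+-comm 2 t)
    (a*c≤d+b∧e≤c⇒a*c*e≤d*c+b*e {suc k} {k} {mCs} {maxDeg 𝓕} [1+k]*mCs≤maxDeg+k minDeg≤mCs)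

  witness : LowerBoundFamily N r
  witness = 𝓕 , admissible ,
    subst₂ (λ t′ m′ → (t′ + 3) * (m′ C s) * minDeg 𝓕 ≤ maxDeg 𝓕 * (m′ C s) + (t′ + 2) * minDeg 𝓕)
      (sym N∸2*r≡t) (sym 2*r∸3≡m) ratio-bound
    where
    N∸2*r≡t : N ∸ 2 * r ≡ t
    N∸2*r≡t = trans (cong (_∸ 2 * r) N≡2*r+t) (m+n∸m≡n (2 * r) t)

lower-bound-family : ∀ n r → 2 ≤ r → 2 * r ≤ n → LowerBoundFamily n r
lower-bound-family n (suc zero) (s≤s ()) _
lower-bound-family n (suc (suc s)) _ 2r≤n =
  subst (λ n → LowerBoundFamily n (suc (suc s))) (trans (Construction.N≡2*r+t s t) (m+[n∸m]≡n 2r≤n)) (Construction.witness s t)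
  where
  t : ℕ
  t = n ∸ 2 * suc (suc s)

theorem1p1 :
    -- (i)  M(n,r) ≤ n + r^r, i.e. Δ(𝓕)/δ(𝓕) ≤ n + r^r for every admissible 𝓕
    (∀ (n r : ℕ) → 1 ≤ n → 1 ≤ r → (𝓕 : Family n) → Admissible n r 𝓕 →
      maxDeg 𝓕 ≤ (n + r ^ r) * minDeg 𝓕)
    ×
    -- (ii) for 2r+2 < n some admissible 𝓕 has
    --      Δ/δ ≥ (n-2r+3) - (n-2r+2)/C(2r-3,r-2)   (cross-multiplied)
    (∀ (n r : ℕ) → 2 ≤ r → 2 * r + 2 < n →
      Σ (Family n) λ 𝓕 → Admissible n r 𝓕 ×
        ((n ∸ 2 * r + 3) * ((2 * r ∸ 3) C (r ∸ 2)) * minDeg 𝓕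
          ≤ maxDeg 𝓕 * ((2 * r ∸ 3) C (r ∸ 2)) + (n ∸ 2 * r + 2) * minDeg 𝓕))
theorem1p1 = (λ _ _ _ _ → maxDeg≤[n+r^r]*minDeg)
           , λ n r 2≤r 2r+2<n → lower-bound-family n r 2≤r (≤-trans (m≤m+n (2 * r) 2) (<⇒≤ 2r+2<n))
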